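{- Let $r\ge4$, $q=\lfloor r/2\rfloor$, $j\in\{2,\dots,q\}$, and let $\mathcal{H}_{uv}$ be the $(r,j)$-maxcut-gadget on nodes $u,v$ with terminals $s,t$. Equip every hyperedge of $\mathcal{H}_{uv}$ with the cardinality-based splitting function with penalties $w_1,\dots,w_q\ge0$ satisfying $0<w_j<w_1$ and $w_j\le w_i$ for all $i\in\{2,\dots,q\}$. Then the minimum $s$-$t$ cut value in $\mathcal{H}_{uv}$ is $w_j$, and it is attained only by bipartitions in which $u$ and $v$ are on different sides. Moreover, if $u$ and $v$ are constrained to lie on the same side, the minimum $s$-$t$ cut value is strictly greater than $w_j$.
   Context: The $(r,j)$-maxcut-gadget on $(u,v)$ with terminals $s,t$ is the hypergraph whose nodes are $u,v,s,t$ together with pairwise disjoint new node sets $A$ ($|A|=j-2$), $B$ ($|B|=r-j-2$), $U$ ($|U|=j+1$), $W$ ($|W|=r-j+1$), and whose three hyperedges are $h_{st}=\{u,v,s,t\}\cup A\cup B$, $h_u=\{u\}\cup B\cup U$, $h_v=\{v\}\cup A\cup W$ (each of size $r$). The cardinality-based splitting function with penalties $w_1,\dots,w_q$ assigns $\mathbf{w}_e(S)=0$ if $S\in\{\emptyset,e\}$ and $\mathbf{w}_e(S)=w_i$ with $i=\min\{|S|,|e\setminus S|\}$ otherwise. An $s$-$t$ cut is a set $S$ of nodes with $s\in S$, $t\notin S$, of value $\sum_e\mathbf{w}_e(e\cap S)$; the minimum $s$-$t$ cut value is the minimum over all such $S$.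
   Formalization: The penalties $w_1,\dots,w_q$ of the cardinality-based splitting function take rational values. -}

module Defs where

open import Data.Nat using (ℕ; zero; suc; _+_; _∸_; _≟_; _⊓_)
open import Data.Bool using (Bool; true; false; _∧_; if_then_else_)
open import Data.Fin using (Fin)
open import Data.List using (List; []; _∷_; _++_; map; allFin)
open import Data.Rational using (ℚ; 0ℚ) renaming (_+_ to _+ℚ_)
open import Data.Product using (_×_)
open import Relation.Binary.PropositionalEquality using (_≡_)
open import Relation.Nullary.Decidable using (⌊_⌋)

data Node (r j : ℕ) : Set where
  nu nv ns nt : Node r j
  na : Fin (j ∸ 2) → Node r j
  nb : Fin (r ∸ j ∸ 2) → Node r j
  nU : Fin (j + 1) → Node r j
  nW : Fin (r ∸ j + 1) → Node r j

allNodes : (r j : ℕ) → List (Node r j)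
allNodes r j = nu ∷ nv ∷ ns ∷ nt ∷
  (map na (allFin _) ++ map nb (allFin _) ++ map nU (allFin _) ++ map nW (allFin _))

NodeSet : ℕ → ℕ → Set
NodeSet r j = Node r j → Bool

hst : ∀ {r j} → NodeSet r j
hst nu = true
hst nv = true
hst ns = true
hst nt = true
hst (na _) = true
hst (nb _) = true
hst (nU _) = false
hst (nW _) = false

hu : ∀ {r j} → NodeSet r j
hu nu = true
hu (nb _) = true
hu (nU _) = true
hu _ = false

hv : ∀ {r j} → NodeSet r j
hv nv = true
hv (na _) = true
hv (nW _) = true
hv _ = false

gadgetEdges : (r j : ℕ) → List (NodeSet r j)
gadgetEdges r j = hst ∷ hu ∷ hv ∷ []

countL : ∀ {X : Set} → (X → Bool) → List X → ℕ
countL P [] = 0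
countL P (x ∷ xs) = (if P x then 1 else 0) + countL P xs

card : ∀ {r j} → NodeSet r j → ℕ
card {r} {j} P = countL P (allNodes r j)

_∩_ : ∀ {r j} → NodeSet r j → NodeSet r j → NodeSet r j
(P ∩ Q) x = P x ∧ Q x

-- Cardinality-based splitting function with penalties w (w i used for i = 1..q):
-- w_e(S) = 0 if |S| = 0 or |S| = |e|, otherwise w_{min(|S|, |e| - |S|)}.
splitW : (w : ℕ → ℚ) → (size k : ℕ) → ℚ
splitW w size zero = 0ℚ
splitW w size (suc k) =
  if ⌊ suc k ≟ size ⌋ then 0ℚ else w (suc k ⊓ (size ∸ suc k))

cutValue : ∀ {r j} → (w : ℕ → ℚ) → List (NodeSet r j) → NodeSet r j → ℚ
cutValue w [] S = 0ℚ
cutValue w (e ∷ es) S = splitW w (card e) (card (e ∩ S)) +ℚ cutValue w es S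

gadgetCut : (r j : ℕ) → (w : ℕ → ℚ) → NodeSet r j → ℚ
gadgetCut r j w S = cutValue w (gadgetEdges r j) S

IsSTCut : ∀ {r j} → NodeSet r j → Set
IsSTCut S = (S ns ≡ true) × (S nt ≡ false)

module Submission where

-- Every hyperedge of the gadget has exactly r nodes.  An s-t cut
-- always cuts h_st (it contains s but not t), so it pays at least w_j there,
-- and the other two edges cost ≥ 0; this is the lower bound.  The cut
-- S₀ = {u, s} ∪ B ∪ U leaves h_u and h_v uncut and meets h_st in r - j nodes,
-- so it costs exactly w_j.  If u and v lie on the same side, either h_u or h_v
-- is cut (adding a positive cost to the w_j paid on h_st), or both are uncut;
-- then A and B follow u and v, so S isolates exactly one node (s or t) of h_st
-- and pays w_1 > w_j there.  Minimal cuts therefore separate u from v.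

open import Defs
open import Data.Nat using (ℕ; zero; suc; _+_; _*_; _∸_; _/_; _⊓_; _≟_; z≤n; s≤s)
  renaming (_≤_ to _≤ℕ_; _<_ to _<ℕ_)
open import Data.Nat.Properties as ℕP using ()
open import Data.Nat.DivMod using (m*n/n≡m; /-monoˡ-≤; m/n*n≤m)
open import Data.Nat.Tactic.RingSolver using (solve)
open import Data.Rational using (ℚ; 0ℚ; _≤_; _<_) renaming (_+_ to _+ℚ_)
open import Data.Rational.Properties as ℚP using ()
open import Data.Bool using (Bool; true; false; if_then_else_)
open import Data.Bool.Properties using (∧-identityʳ)
open import Data.Fin using (Fin)
open import Data.List using (List; []; _∷_; _++_; map; allFin; length)
open import Data.List.Properties using (length-tabulate)
open import Data.Product using (_×_; ∃; _,_)
open import Data.Sum using (_⊎_; inj₁; inj₂)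
open import Data.Empty using (⊥-elim)
open import Relation.Nullary using (yes; no)
open import Relation.Binary.PropositionalEquality

bit : Bool → ℕ
bit b = if b then 1 else 0

bit≤1 : ∀ b → bit b ≤ℕ 1
bit≤1 true  = s≤s z≤n
bit≤1 false = z≤n

countL-++ : ∀ {X : Set} (P : X → Bool) xs ys →
  countL P (xs ++ ys) ≡ countL P xs + countL P ys
countL-++ P []       ys = refl
countL-++ P (x ∷ xs) ys =
  trans (cong (bit (P x) +_) (countL-++ P xs ys)) (sym (ℕP.+-assoc (bit (P x)) _ _))

countL-map : ∀ {X Y : Set} (P : Y → Bool) (f : X → Y) xs →
  countL P (map f xs) ≡ countL (λ x → P (f x)) xs
countL-map P f []       = refl
countL-map P f (x ∷ xs) = cong (bit (P (f x)) +_) (countL-map P f xs)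

countL-map-++ : ∀ {X Y : Set} (P : Y → Bool) (f : X → Y) xs ys →
  countL P (map f xs ++ ys) ≡ countL (λ x → P (f x)) xs + countL P ys
countL-map-++ P f xs ys =
  trans (countL-++ P (map f xs) ys) (cong (_+ countL P ys) (countL-map P f xs))

countL-cong : ∀ {X : Set} {P Q : X → Bool} → (∀ x → P x ≡ Q x) → ∀ xs →
  countL P xs ≡ countL Q xs
countL-cong P≗Q []       = refl
countL-cong P≗Q (x ∷ xs) = cong₂ (λ b n → bit b + n) (P≗Q x) (countL-cong P≗Q xs)

countL-≤-length : ∀ {X : Set} (P : X → Bool) xs → countL P xs ≤ℕ length xs
countL-≤-length P []       = z≤n
countL-≤-length P (x ∷ xs) = ℕP.+-mono-≤ (bit≤1 (P x)) (countL-≤-length P xs)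

countL-false : ∀ {X : Set} (xs : List X) → countL (λ _ → false) xs ≡ 0
countL-false []       = refl
countL-false (x ∷ xs) = countL-false xs

countL-true : ∀ {X : Set} (xs : List X) → countL (λ _ → true) xs ≡ length xs
countL-true []       = refl
countL-true (x ∷ xs) = cong suc (countL-true xs)

length-allFin : ∀ n → length (allFin n) ≡ n
length-allFin n = length-tabulate {n = n} (λ i → i)

countL-allFin-≤ : ∀ n (P : Fin n → Bool) → countL P (allFin n) ≤ℕ n
countL-allFin-≤ n P = subst (countL P (allFin n) ≤ℕ_) (length-allFin n) (countL-≤-length P (allFin n))

countL-allFin-true : ∀ n → countL (λ (_ : Fin n) → true) (allFin n) ≡ n
countL-allFin-true n = trans (countL-true (allFin n)) (length-allFin n)

module _ {r j : ℕ} where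

  inA inB inU inW : NodeSet r j → ℕ
  inA S = countL (λ i → S (na i)) (allFin (j ∸ 2))
  inB S = countL (λ i → S (nb i)) (allFin (r ∸ j ∸ 2))
  inU S = countL (λ i → S (nU i)) (allFin (j + 1))
  inW S = countL (λ i → S (nW i)) (allFin (r ∸ j + 1))

  inA≤ : ∀ S → inA S ≤ℕ j ∸ 2
  inA≤ S = countL-allFin-≤ _ _
  inB≤ : ∀ S → inB S ≤ℕ r ∸ j ∸ 2
  inB≤ S = countL-allFin-≤ _ _
  inU≤ : ∀ S → inU S ≤ℕ j + 1
  inU≤ S = countL-allFin-≤ _ _
  inW≤ : ∀ S → inW S ≤ℕ r ∸ j + 1
  inW≤ S = countL-allFin-≤ _ _

  card-by-blocks : ∀ (S : NodeSet r j) → card S ≡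
    bit (S nu) + (bit (S nv) + (bit (S ns) + (bit (S nt) + (inA S + (inB S + (inU S + inW S))))))
  card-by-blocks S =
    cong (λ z → bit (S nu) + (bit (S nv) + (bit (S ns) + (bit (S nt) + z)))) (begin
      countL S (map na (allFin (j ∸ 2)) ++ map nb (allFin (r ∸ j ∸ 2)) ++ map nU (allFin (j + 1)) ++ map nW (allFin (r ∸ j + 1)))
        ≡⟨ countL-map-++ S na (allFin (j ∸ 2)) _ ⟩
      inA S + countL S (map nb (allFin (r ∸ j ∸ 2)) ++ map nU (allFin (j + 1)) ++ map nW (allFin (r ∸ j + 1)))
        ≡⟨ cong (inA S +_) (countL-map-++ S nb (allFin (r ∸ j ∸ 2)) _) ⟩
      inA S + (inB S + countL S (map nU (allFin (j + 1)) ++ map nW (allFin (r ∸ j + 1))))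
        ≡⟨ cong (λ z → inA S + (inB S + z)) (countL-map-++ S nU (allFin (j + 1)) _) ⟩
      inA S + (inB S + (inU S + countL S (map nW (allFin (r ∸ j + 1)))))
        ≡⟨ cong (λ z → inA S + (inB S + (inU S + z))) (countL-map S nW (allFin (r ∸ j + 1))) ⟩
      inA S + (inB S + (inU S + inW S)) ∎)
    where open ≡-Reasoning

  hst-trace : ∀ S → card (hst ∩ S) ≡
    bit (S nu) + (bit (S nv) + (bit (S ns) + (bit (S nt) + (inA S + inB S))))
  hst-trace S = trans (card-by-blocks (hst ∩ S))
    (cong (λ z → bit (S nu) + (bit (S nv) + (bit (S ns) + (bit (S nt) + (inA S + z)))))
      (trans (cong₂ (λ x y → inB S + (x + y)) (countL-false (allFin (j + 1))) (countL-false (allFin (r ∸ j + 1))))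
             (ℕP.+-identityʳ (inB S))))

  hu-trace : ∀ S → card (hu ∩ S) ≡ bit (S nu) + (inB S + inU S)
  hu-trace S = begin
    card (hu ∩ S)
      ≡⟨ card-by-blocks (hu ∩ S) ⟩
    bit (S nu) + (countL (λ _ → false) (allFin (j ∸ 2)) + (inB S + (inU S + countL (λ _ → false) (allFin (r ∸ j + 1)))))
      ≡⟨ cong₂ (λ x y → bit (S nu) + (x + (inB S + (inU S + y)))) (countL-false (allFin (j ∸ 2))) (countL-false (allFin (r ∸ j + 1))) ⟩
    bit (S nu) + (inB S + (inU S + 0))
      ≡⟨ cong (λ z → bit (S nu) + (inB S + z)) (ℕP.+-identityʳ (inU S)) ⟩
    bit (S nu) + (inB S + inU S) ∎
    where open ≡-Reasoning

  hv-trace : ∀ S → card (hv ∩ S) ≡ bit (S nv) + (inA S + inW S)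
  hv-trace S = trans (card-by-blocks (hv ∩ S))
    (cong₂ (λ x y → bit (S nv) + (inA S + (x + (y + inW S)))) (countL-false (allFin (r ∸ j ∸ 2))) (countL-false (allFin (j + 1))))

  hst-trace-st : ∀ S → IsSTCut S → card (hst ∩ S) ≡ bit (S nu) + (bit (S nv) + suc (inA S + inB S))
  hst-trace-st S (s∈S , t∉S) = trans (hst-trace S)
    (cong₂ (λ p q → bit (S nu) + (bit (S nv) + (bit p + (bit q + (inA S + inB S))))) s∈S t∉S)

  full : NodeSet r j
  full _ = true

  card-∩-full : ∀ e → card e ≡ card (e ∩ full)
  card-∩-full e = countL-cong (λ x → sym (∧-identityʳ (e x))) (allNodes r j)

-- The facts about |A| = j-2, |B| = r-j-2, |U| = j+1, |W| = r-j+1 that the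
-- cut analysis uses: each hyperedge has r nodes, and |{u,s} ∪ B| = r - j ≥ j.
record GadgetSizes (r j : ℕ) : Set where
  field
    2≤j       : 2 ≤ℕ j
    hst-size  : 4 + ((j ∸ 2) + (r ∸ j ∸ 2)) ≡ r
    hu-size   : 1 + ((r ∸ j ∸ 2) + (j + 1)) ≡ r
    hv-size   : 1 + ((j ∸ 2) + (r ∸ j + 1)) ≡ r
    co-size   : (2 + (r ∸ j ∸ 2)) + j ≡ r
    j≤co-size : j ≤ℕ 2 + (r ∸ j ∸ 2)

block-arith : ∀ α β {d r} → 2 + β ≡ d → 2 + α + d ≡ r →
  (4 + (α + β) ≡ r) × (1 + (β + (2 + α + 1)) ≡ r) × (1 + (α + (d + 1)) ≡ r) × (2 + β + (2 + α) ≡ r)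
block-arith α β refl refl =
  solve (α ∷ β ∷ []) , solve (α ∷ β ∷ []) , solve (α ∷ β ∷ []) , solve (α ∷ β ∷ [])

gadget-sizes : ∀ {r j} → 2 ≤ℕ j → j + j ≤ℕ r → GadgetSizes r j
gadget-sizes {r} {j@(suc (suc α))} 2≤j@(s≤s (s≤s _)) j+j≤r =
  let (st-size , u-size , v-size , split-size) = block-arith α (d ∸ 2) d-split r-split
  in record { 2≤j = 2≤j ; hst-size = st-size ; hu-size = u-size ; hv-size = v-size ; co-size = split-size
            ; j≤co-size = subst (j ≤ℕ_) (sym d-split) j≤d }
  where
  d : ℕ
  d = r ∸ j
  j≤d : j ≤ℕ d
  j≤d = ℕP.m+n≤o⇒m≤o∸n j j+j≤r
  d-split : 2 + (d ∸ 2) ≡ d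
  d-split = ℕP.m+[n∸m]≡n (ℕP.≤-trans 2≤j j≤d)
  r-split : j + d ≡ r
  r-split = ℕP.m+[n∸m]≡n (ℕP.≤-trans (ℕP.m≤m+n j j) j+j≤r)

m*2≡m+m : ∀ m → m * 2 ≡ m + m
m*2≡m+m m = solve (m ∷ [])

double≤⇒≤half : ∀ m n → m + m ≤ℕ n → m ≤ℕ n / 2
double≤⇒≤half m n m+m≤n =
  subst (_≤ℕ n / 2) (m*n/n≡m m 2) (/-monoˡ-≤ 2 (subst (_≤ℕ n) (sym (m*2≡m+m m)) m+m≤n))

≤half⇒double≤ : ∀ m n → m ≤ℕ n / 2 → m + m ≤ℕ n
≤half⇒double≤ m n m≤n/2 = subst (_≤ℕ n) (m*2≡m+m m)
  (ℕP.≤-trans (ℕP.*-monoˡ-≤ 2 m≤n/2) (m/n*n≤m n 2))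

Uncut : ℕ → ℕ → Set
Uncut n k = k ≡ 0 ⊎ k ≡ n

UncutOrCut : ℕ → ℕ → Set
UncutOrCut n k = Uncut n k ⊎ (0 <ℕ k × k <ℕ n)

cut-trichotomy : ∀ {n} k → k ≤ℕ n → UncutOrCut n k
cut-trichotomy zero    _ = inj₁ (inj₁ refl)
cut-trichotomy {n} (suc k) k<n with suc k ≟ n
... | yes k≡n = inj₁ (inj₂ k≡n)
... | no  k≢n = inj₂ (s≤s z≤n , ℕP.≤∧≢⇒< k<n k≢n)

module _ (w : ℕ → ℚ) where

  split-full : ∀ n → splitW w n n ≡ 0ℚ
  split-full zero    = refl
  split-full (suc n) with suc n ≟ suc n
  ... | yes _   = refl
  ... | no  n≢n = ⊥-elim (n≢n refl)

  split-uncut : ∀ {n k} → Uncut n k → splitW w n k ≡ 0ℚ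
  split-uncut         (inj₁ refl) = refl
  split-uncut {n = n} (inj₂ refl) = split-full n

  split-cut : ∀ {n} k → 0 <ℕ k → k <ℕ n → splitW w n k ≡ w (k ⊓ (n ∸ k))
  split-cut {n} (suc k) _ k<n with suc k ≟ n
  ... | yes refl = ⊥-elim (ℕP.<-irrefl refl k<n)
  ... | no  _    = refl

  split-sides : ∀ {n} k m → k + m ≡ n → m ≤ℕ k → 0 <ℕ m → splitW w n k ≡ w m
  split-sides k m refl m≤k 0<m = begin
    splitW w (k + m) k  ≡⟨ split-cut k (ℕP.<-≤-trans 0<m m≤k) (ℕP.m<m+n k 0<m) ⟩
    w (k ⊓ (k + m ∸ k)) ≡⟨ cong (λ i → w (k ⊓ i)) (ℕP.m+n∸m≡n k m) ⟩
    w (k ⊓ m)           ≡⟨ cong w (ℕP.m≥n⇒m⊓n≡n m≤k) ⟩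
    w m                 ∎
    where open ≡-Reasoning

  split-single : ∀ {n k} → 2 ≤ℕ n → k ≡ 1 ⊎ k + 1 ≡ n → splitW w n k ≡ w 1
  split-single (s≤s (s≤s _)) (inj₁ refl) = refl
  split-single {k = k} 2≤n (inj₂ k+1≡n) =
    split-sides k 1 k+1≡n (ℕP.+-cancelʳ-≤ 1 1 k (subst (2 ≤ℕ_) (sym k+1≡n) 2≤n)) (s≤s z≤n)

smaller-side-range : ∀ {n} k → 0 <ℕ k → k <ℕ n → 1 ≤ℕ k ⊓ (n ∸ k) × k ⊓ (n ∸ k) ≤ℕ n / 2
smaller-side-range {n} k 0<k k<n =
  ℕP.⊓-glb 0<k (ℕP.m<n⇒0<n∸m k<n) ,
  double≤⇒≤half (k ⊓ (n ∸ k)) n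
    (ℕP.≤-trans (ℕP.+-mono-≤ (ℕP.m⊓n≤m k (n ∸ k)) (ℕP.m⊓n≤n k (n ∸ k)))
                (ℕP.≤-reflexive (ℕP.m+[n∸m]≡n (ℕP.<⇒≤ k<n))))

≤-+-nonneg : ∀ {c x y} → c ≤ x → 0ℚ ≤ y → c ≤ x +ℚ y
≤-+-nonneg {c} c≤x 0≤y = subst (_≤ _) (ℚP.+-identityʳ c) (ℚP.+-mono-≤ c≤x 0≤y)

<-+-nonneg : ∀ {c x y} → c < x → 0ℚ ≤ y → c < x +ℚ y
<-+-nonneg {c} c<x 0≤y = subst (_< _) (ℚP.+-identityʳ c) (ℚP.+-mono-<-≤ c<x 0≤y)

≤-+-pos : ∀ {c x y} → c ≤ x → 0ℚ < y → c < x +ℚ y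
≤-+-pos {c} c≤x 0<y = subst (_< _) (ℚP.+-identityʳ c) (ℚP.+-mono-≤-< c≤x 0<y)

module Penalties (w : ℕ → ℚ) (n j : ℕ) (wj>0 : 0ℚ < w j) (wj<w1 : w j < w 1)
                 (wj≤wi : ∀ i → 2 ≤ℕ i → i ≤ℕ n / 2 → w j ≤ w i) where

  wj-least : ∀ i → 1 ≤ℕ i → i ≤ℕ n / 2 → w j ≤ w i
  wj-least (suc zero)    _ _     = ℚP.<⇒≤ wj<w1
  wj-least (suc (suc i)) _ i≤n/2 = wj≤wi (suc (suc i)) (s≤s (s≤s z≤n)) i≤n/2

  cut-cost≥wj : ∀ k → 0 <ℕ k → k <ℕ n → w j ≤ splitW w n k
  cut-cost≥wj k 0<k k<n =
    let (1≤m , m≤n/2) = smaller-side-range k 0<k k<n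
    in subst (w j ≤_) (sym (split-cut w k 0<k k<n)) (wj-least _ 1≤m m≤n/2)

  cut-cost-pos : ∀ k → 0 <ℕ k → k <ℕ n → 0ℚ < splitW w n k
  cut-cost-pos k 0<k k<n = ℚP.<-≤-trans wj>0 (cut-cost≥wj k 0<k k<n)

  cost-nonneg : ∀ k → k ≤ℕ n → 0ℚ ≤ splitW w n k
  cost-nonneg k k≤n with cut-trichotomy k k≤n
  ... | inj₁ uncut       = ℚP.≤-reflexive (sym (split-uncut w uncut))
  ... | inj₂ (0<k , k<n) = ℚP.<⇒≤ (cut-cost-pos k 0<k k<n)

saturated : ∀ {b c B C} → b ≤ℕ B → c ≤ℕ C → b + c ≡ B + C → b ≡ B
saturated b≤B c≤C b+c≡B+C =
  ℕP.≤-antisym b≤B (ℕP.≮⇒≥ (λ b<B → ℕP.<⇒≢ (ℕP.+-mono-<-≤ b<B c≤C) b+c≡B+C))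

-- An edge {x} ∪ X ∪ Y (|X| = B, |Y| = C) that S does not cut contains b = |X ∩ S|
-- members of S in X: all of X if x ∈ S (p = true), none of it otherwise.
uncut-follows : ∀ p {b c B C} → b ≤ℕ B → c ≤ℕ C →
  Uncut (1 + (B + C)) (bit p + (b + c)) → b ≡ (if p then B else 0)
uncut-follows false _   _   (inj₁ b+c≡0)   = ℕP.m+n≡0⇒m≡0 _ b+c≡0
uncut-follows false b≤B c≤C (inj₂ b+c≡1+B+C) =
  ⊥-elim (ℕP.<⇒≢ (s≤s (ℕP.+-mono-≤ b≤B c≤C)) b+c≡1+B+C)
uncut-follows true  _   _   (inj₁ ())
uncut-follows true  b≤B c≤C (inj₂ 1+b+c≡1+B+C) = saturated b≤B c≤C (ℕP.suc-injective 1+b+c≡1+B+C)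

-- In h_st = {u, v, s, t} ∪ A ∪ B, if u, v, A and B all lie on the side of S
-- given by p, then S ∩ h_st is {s} (p = false) or h_st minus t (p = true).
isolated-terminal : ∀ p q {A B a b n} → p ≡ q → 4 + (A + B) ≡ n →
  a ≡ (if q then A else 0) → b ≡ (if p then B else 0) →
  bit p + (bit q + suc (a + b)) ≡ 1 ⊎ bit p + (bit q + suc (a + b)) + 1 ≡ n
isolated-terminal false .false refl _ refl refl = inj₁ refl
isolated-terminal true .true {A} {B} refl refl refl refl = inj₂ (ℕP.+-comm (3 + (A + B)) 1)

module CutAnalysis {r j : ℕ} (sizes : GadgetSizes r j) (w : ℕ → ℚ)
                   (wj>0 : 0ℚ < w j) (wj<w1 : w j < w 1)
                   (wj≤wi : ∀ i → 2 ≤ℕ i → i ≤ℕ r / 2 → w j ≤ w i) where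
  open GadgetSizes sizes
  open Penalties w r j wj>0 wj<w1 wj≤wi

  hst-card : card (hst {r} {j}) ≡ r
  hst-card = trans (card-∩-full {r} {j} hst) (trans (hst-trace {r} {j} full)
    (trans (cong₂ (λ a b → 4 + (a + b)) (countL-allFin-true (j ∸ 2)) (countL-allFin-true (r ∸ j ∸ 2)))
           hst-size))

  hu-card : card (hu {r} {j}) ≡ r
  hu-card = trans (card-∩-full {r} {j} hu) (trans (hu-trace {r} {j} full)
    (trans (cong₂ (λ b c → 1 + (b + c)) (countL-allFin-true (r ∸ j ∸ 2)) (countL-allFin-true (j + 1)))
           hu-size))

  hv-card : card (hv {r} {j}) ≡ r
  hv-card = trans (card-∩-full {r} {j} hv) (trans (hv-trace {r} {j} full)
    (trans (cong₂ (λ a c → 1 + (a + c)) (countL-allFin-true (j ∸ 2)) (countL-allFin-true (r ∸ j + 1)))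
           hv-size))

  2≤r : 2 ≤ℕ r
  2≤r = subst (2 ≤ℕ_) hst-size (s≤s (s≤s z≤n))

  cost-st cost-u cost-v : NodeSet r j → ℚ
  cost-st S = splitW w r (card (hst ∩ S))
  cost-u  S = splitW w r (card (hu ∩ S))
  cost-v  S = splitW w r (card (hv ∩ S))

  cut-terms : ∀ (S : NodeSet r j) → gadgetCut r j w S ≡ cost-st S +ℚ (cost-u S +ℚ cost-v S)
  cut-terms S =
    cong₂ _+ℚ_ (cong (λ n → splitW w n (card (hst ∩ S))) hst-card)
      (cong₂ _+ℚ_ (cong (λ n → splitW w n (card (hu ∩ S))) hu-card)
        (trans (cong (λ n → splitW w n (card (hv ∩ S)) +ℚ 0ℚ) hv-card) (ℚP.+-identityʳ (cost-v S))))

  hst-is-cut : ∀ (S : NodeSet r j) → IsSTCut S → 0 <ℕ card (hst ∩ S) × card (hst ∩ S) <ℕ r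
  hst-is-cut S st = subst (λ k → 0 <ℕ k × k <ℕ r) (sym (hst-trace-st S st)) (nonempty , proper)
    where
    x : ℕ
    x = suc (inA S + inB S)
    nonempty : 0 <ℕ bit (S nu) + (bit (S nv) + x)
    nonempty = ℕP.≤-trans (s≤s z≤n) (ℕP.≤-trans (ℕP.m≤n+m x (bit (S nv))) (ℕP.m≤n+m _ (bit (S nu))))
    proper : bit (S nu) + (bit (S nv) + x) <ℕ r
    proper = subst (bit (S nu) + (bit (S nv) + x) <ℕ_) hst-size
      (s≤s (ℕP.+-mono-≤ (bit≤1 (S nu)) (ℕP.+-mono-≤ (bit≤1 (S nv)) (s≤s (ℕP.+-mono-≤ (inA≤ S) (inB≤ S))))))

  hu-bound : ∀ (S : NodeSet r j) → card (hu ∩ S) ≤ℕ r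
  hu-bound S = subst₂ _≤ℕ_ (sym (hu-trace S)) hu-size
    (ℕP.+-mono-≤ (bit≤1 (S nu)) (ℕP.+-mono-≤ (inB≤ S) (inU≤ S)))

  hv-bound : ∀ (S : NodeSet r j) → card (hv ∩ S) ≤ℕ r
  hv-bound S = subst₂ _≤ℕ_ (sym (hv-trace S)) hv-size
    (ℕP.+-mono-≤ (bit≤1 (S nv)) (ℕP.+-mono-≤ (inA≤ S) (inW≤ S)))

  cost-st≥wj : ∀ (S : NodeSet r j) → IsSTCut S → w j ≤ cost-st S
  cost-st≥wj S st = let (0<k , k<r) = hst-is-cut S st in cut-cost≥wj _ 0<k k<r

  cost-uv-nonneg : ∀ (S : NodeSet r j) → 0ℚ ≤ cost-u S +ℚ cost-v S
  cost-uv-nonneg S = ≤-+-nonneg (cost-nonneg _ (hu-bound S)) (cost-nonneg _ (hv-bound S))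

  cut≥wj : ∀ (S : NodeSet r j) → IsSTCut S → w j ≤ gadgetCut r j w S
  cut≥wj S st = subst (w j ≤_) (sym (cut-terms S)) (≤-+-nonneg (cost-st≥wj S st) (cost-uv-nonneg S))

  same-side-isolates : ∀ (S : NodeSet r j) → IsSTCut S → S nu ≡ S nv →
    Uncut r (card (hu ∩ S)) → Uncut r (card (hv ∩ S)) →
    card (hst ∩ S) ≡ 1 ⊎ card (hst ∩ S) + 1 ≡ r
  same-side-isolates S st u≡v hu-uncut hv-uncut =
    subst (λ k → k ≡ 1 ⊎ k + 1 ≡ r) (sym (hst-trace-st S st))
      (isolated-terminal (S nu) (S nv) u≡v hst-size
        (uncut-follows (S nv) (inA≤ S) (inW≤ S) (subst₂ Uncut (sym hv-size) (hv-trace S) hv-uncut))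
        (uncut-follows (S nu) (inB≤ S) (inU≤ S) (subst₂ Uncut (sym hu-size) (hu-trace S) hu-uncut)))

  -- Keeping u and v together costs strictly more than w_j: either h_u or h_v
  -- is cut too, or h_st pays w_1.
  same-side-costs-more : ∀ (S : NodeSet r j) → IsSTCut S → S nu ≡ S nv → w j < gadgetCut r j w S
  same-side-costs-more S st u≡v = subst (w j <_) (sym (cut-terms S))
    (by-cases (cut-trichotomy _ (hu-bound S)) (cut-trichotomy _ (hv-bound S)))
    where
    by-cases : UncutOrCut r (card (hu ∩ S)) → UncutOrCut r (card (hv ∩ S)) →
      w j < cost-st S +ℚ (cost-u S +ℚ cost-v S)
    by-cases (inj₂ (0<k , k<r)) _ = ≤-+-pos (cost-st≥wj S st)
      (<-+-nonneg (cut-cost-pos _ 0<k k<r) (cost-nonneg _ (hv-bound S)))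
    by-cases (inj₁ _) (inj₂ (0<k , k<r)) = ≤-+-pos (cost-st≥wj S st)
      (≤-+-pos (cost-nonneg _ (hu-bound S)) (cut-cost-pos _ 0<k k<r))
    by-cases (inj₁ hu-uncut) (inj₁ hv-uncut) = <-+-nonneg
      (subst (w j <_) (sym (split-single w 2≤r (same-side-isolates S st u≡v hu-uncut hv-uncut))) wj<w1)
      (cost-uv-nonneg S)

  optimal-separates : ∀ (S : NodeSet r j) → IsSTCut S → gadgetCut r j w S ≡ w j → S nu ≢ S nv
  optimal-separates S st cost≡wj u≡v = ℚP.<-irrefl (sym cost≡wj) (same-side-costs-more S st u≡v)

  -- The optimal cut {u, s} ∪ B ∪ U: it contains h_u, misses h_v and splits h_st
  -- into sides of sizes r - j and j.
  S₀ : NodeSet r j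
  S₀ nu     = true
  S₀ ns     = true
  S₀ (nb _) = true
  S₀ (nU _) = true
  S₀ _      = false

  S₀-st : IsSTCut S₀
  S₀-st = refl , refl

  S₀-cost : gadgetCut r j w S₀ ≡ w j
  S₀-cost = begin
    gadgetCut r j w S₀                           ≡⟨ cut-terms S₀ ⟩
    cost-st S₀ +ℚ (cost-u S₀ +ℚ cost-v S₀)       ≡⟨ cong₂ _+ℚ_ st-part (cong₂ _+ℚ_ u-part v-part) ⟩
    w j +ℚ (0ℚ +ℚ 0ℚ)                            ≡⟨ ℚP.+-identityʳ (w j) ⟩
    w j                                          ∎
    where
    open ≡-Reasoning
    st-part : cost-st S₀ ≡ w j
    st-part = trans
      (cong (splitW w r) (trans (hst-trace-st S₀ S₀-st)
        (cong₂ (λ a b → 2 + (a + b)) (countL-false (allFin (j ∸ 2))) (countL-allFin-true (r ∸ j ∸ 2)))))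
      (split-sides w (2 + (r ∸ j ∸ 2)) j co-size j≤co-size (ℕP.≤-trans (s≤s z≤n) 2≤j))
    u-part : cost-u S₀ ≡ 0ℚ
    u-part = split-uncut w (inj₂ (trans (hu-trace S₀)
      (trans (cong₂ (λ b c → 1 + (b + c)) (countL-allFin-true (r ∸ j ∸ 2)) (countL-allFin-true (j + 1)))
             hu-size)))
    v-part : cost-v S₀ ≡ 0ℚ
    v-part = split-uncut w (inj₁ (trans (hv-trace S₀)
      (cong₂ _+_ (countL-false (allFin (j ∸ 2))) (countL-false (allFin (r ∸ j + 1))))))

lemma5p3 : (r j : ℕ) → 4 ≤ℕ r → 2 ≤ℕ j → j ≤ℕ r / 2 →
    (w : ℕ → ℚ) →
    (∀ i → 1 ≤ℕ i → i ≤ℕ r / 2 → 0ℚ ≤ w i) →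
    0ℚ < w j → w j < w 1 →
    (∀ i → 2 ≤ℕ i → i ≤ℕ r / 2 → w j ≤ w i) →
    ((∃ λ (S : NodeSet r j) → IsSTCut S × gadgetCut r j w S ≡ w j)
      × (∀ (S : NodeSet r j) → IsSTCut S → w j ≤ gadgetCut r j w S))
    × (∀ (S : NodeSet r j) → IsSTCut S → gadgetCut r j w S ≡ w j → S nu ≢ S nv)
    × (∀ (S : NodeSet r j) → IsSTCut S → S nu ≡ S nv → w j < gadgetCut r j w S)
lemma5p3 r j _ 2≤j j≤r/2 w _ wj>0 wj<w1 wj≤wi =
  ((S₀ , S₀-st , S₀-cost) , cut≥wj) , optimal-separates , same-side-costs-more
  where
  -- 4 ≤ r and the nonnegativity of the penalties follow from the other hypotheses.
  open CutAnalysis (gadget-sizes 2≤j (≤half⇒double≤ j r j≤r/2)) w wj>0 wj<w1 wj≤wi
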